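{- If a matroid $M$ is loopless, isthmusless and disconnected, then $M$ is irreducible with respect to free product.
   Context: For a matroid $M$ on $S$, $\rho(M)$ is its rank, $\nu_M(A)=|A|-\rho_M(A)$, $\lambda_M(A)=\rho(M)-\rho_M(A)$. The free product $M\mathbin{\Box} N$ of $M$ on $S$ and $N$ on $T$ ($S\cap T=\emptyset$) is the matroid on $S\cup T$ whose independent sets are the $A$ with $A\cap S$ independent in $M$ and $\lambda_M(A\cap S)\geq\nu_N(A\cap T)$. A nonempty matroid is irreducible if every factorization of it as a free product of matroids contains it as a factor. Disconnected means $M$ is a direct sum of two matroids on nonempty ground sets. -}

module Defs where

open import Data.Nat using (ℕ; zero; suc; _+_; _∸_; _≤_; _<_; _⊔_)
open import Data.Bool using (Bool; true; false)
open import Data.Fin using (Fin; _↑ˡ_; _↑ʳ_)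
open import Data.Fin.Subset using (Subset; inside; outside; ⊥; ⁅_⁆; _∪_; _∈_; _∉_; _⊆_; ∣_∣)
open import Data.Fin.Subset.Properties using (_⊆?_)
open import Data.Vec using (Vec; []; _∷_; tabulate; lookup)
open import Data.List using (List; []; _∷_; _++_; map; filter; foldr)
open import Data.Product using (Σ; ∃; ∃-syntax; _×_; _,_)
open import Data.Sum using (_⊎_)
open import Relation.Nullary using (Dec; ¬_)
open import Relation.Nullary.Decidable using (_×-dec_)
open import Function.Bundles using (_↔_; _⇔_; Inverse)

record Matroid (n : ℕ) : Set₁ where
  field
    Indep     : Subset n → Set
    indep?    : (I : Subset n) → Dec (Indep I)
    indep-⊥   : Indep ⊥
    indep-⊆   : ∀ {I J} → I ⊆ J → Indep J → Indep I
    indep-aug : ∀ {I J} → Indep I → Indep J → ∣ I ∣ < ∣ J ∣ →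
                ∃[ x ] (x ∈ J × x ∉ I × Indep (⁅ x ⁆ ∪ I))

open Matroid public

allSubsets : (n : ℕ) → List (Subset n)
allSubsets zero = [] ∷ []
allSubsets (suc n) = map (outside ∷_) (allSubsets n) ++ map (inside ∷_) (allSubsets n)

maxList : List ℕ → ℕ
maxList = foldr _⊔_ 0

rk : ∀ {n} → Matroid n → Subset n → ℕ
rk {n} M A = maxList (map ∣_∣ (filter (λ I → (I ⊆? A) ×-dec indep? M I) (allSubsets n)))

full : ∀ {n} → Subset n
full {n} = tabulate (λ _ → inside)

rank : ∀ {n} → Matroid n → ℕ
rank M = rk M full

-- ν_M(A) = |A| - ρ_M(A)   (never truncated, since ρ_M(A) ≤ |A|)
nullity : ∀ {n} → Matroid n → Subset n → ℕ
nullity M A = ∣ A ∣ ∸ rk M A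

-- λ_M(A) = ρ(M) - ρ_M(A)   (never truncated, since ρ_M(A) ≤ ρ(M))
corank : ∀ {n} → Matroid n → Subset n → ℕ
corank M A = rank M ∸ rk M A

pre : ∀ {m n} → (Fin m → Fin n) → Subset n → Subset m
pre f Y = tabulate (λ i → lookup Y (f i))

-- for A ⊆ S ∪ T with S = Fin a (left), T = Fin b (right)
leftPart : ∀ {a b} → Subset (a + b) → Subset a
leftPart {a} {b} = pre (λ i → i ↑ˡ b)

rightPart : ∀ {a b} → Subset (a + b) → Subset b
rightPart {a} {b} = pre (λ j → a ↑ʳ j)

FreeProdIndep : ∀ {a b} → Matroid a → Matroid b → Subset (a + b) → Set
FreeProdIndep M N A =
  Indep M (leftPart A) × nullity N (rightPart A) ≤ corank M (leftPart A)

DirectSumIndep : ∀ {a b} → Matroid a → Matroid b → Subset (a + b) → Set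
DirectSumIndep M N A = Indep M (leftPart A) × Indep N (rightPart A)

IsoTo : ∀ {n m} → Matroid n → (Subset m → Set) → Set
IsoTo {n} {m} M P = Σ (Fin n ↔ Fin m) λ σ →
  (Y : Subset m) → P Y ⇔ Indep M (pre (Inverse.to σ) Y)

_≅_ : ∀ {n m} → Matroid n → Matroid m → Set
M ≅ N = IsoTo M (Indep N)

record FreeFactorization {n : ℕ} (M : Matroid n) : Set₁ where
  field
    a b : ℕ
    N₁  : Matroid a
    N₂  : Matroid b
    iso : IsoTo M (FreeProdIndep N₁ N₂)

Irreducible : ∀ {n} → Matroid n → Set₁
Irreducible {n} M =
  1 ≤ n × ((F : FreeFactorization M) →
    (FreeFactorization.N₁ F ≅ M) ⊎ (FreeFactorization.N₂ F ≅ M))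

IsLoop : ∀ {n} → Matroid n → Fin n → Set
IsLoop M e = ¬ Indep M ⁅ e ⁆

Loopless : ∀ {n} → Matroid n → Set
Loopless {n} M = (e : Fin n) → ¬ IsLoop M e

IsBasis : ∀ {n} → Matroid n → Subset n → Set
IsBasis {n} M B = Indep M B × ((e : Fin n) → e ∉ B → ¬ Indep M (⁅ e ⁆ ∪ B))

IsIsthmus : ∀ {n} → Matroid n → Fin n → Set
IsIsthmus {n} M e = (B : Subset n) → IsBasis M B → e ∈ B

Isthmusless : ∀ {n} → Matroid n → Set
Isthmusless {n} M = (e : Fin n) → ¬ IsIsthmus M e

Disconnected : ∀ {n} → Matroid n → Set₁
Disconnected {n} M = Σ ℕ λ a → Σ ℕ λ b → 1 ≤ a × 1 ≤ b ×
  Σ (Matroid a) λ N₁ → Σ (Matroid b) λ N₂ → IsoTo M (DirectSumIndep N₁ N₂)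

-- If M ≅ N₁ □ N₂ with both factors nonempty, any element s of N₁ and t of N₂ lie on a common
-- circuit of M: since M has no loops, s extends to a basis B of N₁, and since t is no isthmus,
-- N₂ has a basis K avoiding t. In B ∪ K ∪ {t} the N₂-part has nullity 1 while B has corank 0,
-- so the set is dependent; removing t makes the N₂-part independent, and removing s raises the
-- corank of the N₁-part to 1, so both remainders are independent. Elements on a common circuit
-- lie in the same summand of a direct sum, so all of M would lie in one of the two nonempty
-- summands of its disconnection. Hence one factor is empty, and then the other one is M.

module Submission where

open import Defs
open import Data.Nat using (ℕ; zero; suc; _+_; _∸_; _≤_; _<_; z≤n; s≤s)
open import Data.Nat.Properties
  using (≤-refl; ≤-trans; ≤-antisym; <-irrefl; ≮⇒≥; ⊔-sel; m⊔n≤o⇒m≤o; m⊔n≤o⇒n≤o; n∸n≡0; 0∸n≡0;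
         m∸n≡0⇒m≤n; n≤0⇒n≡0; <⇒≱; ∸-monoʳ-≤; m+n∸n≡m; m+[n∸m]≡n; +-suc; +-identityʳ; m<m+n; m<n⇒0<n∸m)
open import Data.Bool using (Bool; true; false)
import Data.Bool.Properties as Bool
open import Data.Fin using (Fin; zero; suc; _↑ˡ_; _↑ʳ_; splitAt; cast)
open import Data.Fin.Properties
  using (splitAt-↑ˡ; splitAt-↑ʳ; splitAt⁻¹-↑ˡ; splitAt⁻¹-↑ʳ; ↑ˡ-injective; ↑ʳ-injective;
         toℕ-injective; toℕ-↑ˡ; toℕ-cast; toℕ<n)
open import Data.Fin.Subset using (Subset; inside; outside; ⁅_⁆; _∪_; _─_; _-_; _∈_; _∉_; _⊆_; ∣_∣)
  renaming (⊥ to ∅)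
open import Data.Fin.Subset.Properties
  using (_∈?_; _⊆?_; x∈⁅x⁆; x∈⁅y⁆⇒x≡y; x∈p∪q⁻; x∈p∪q⁺; x∈p∧x∉q⇒x∈p─q; p⊆p∪q; q⊆p∪q; p─⊥≡p; p─q⊆p; ∪-identityˡ;
         ⊆-refl; ⊆-trans; ⊆-antisym; ⊆-min; ∣⊥∣≡0; Empty-unique; p⊆q⇒∣p∣≤∣q∣; p⊂q⇒∣p∣<∣q∣;
         x∈p⇒∣p-x∣<∣p∣)
open import Data.Vec using ([]; _∷_; lookup; _++_; here; there)
open import Data.Vec.Properties
  using (lookup∘tabulate; tabulate∘lookup; tabulate-cong; lookup-++ˡ; lookup-++ʳ;
         []=⇒lookup; lookup⇒[]=)
open import Data.List using (List; map; filter)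
import Data.List.Membership.Propositional as List
open import Data.List.Membership.Propositional.Properties
  using (∈-map⁺; ∈-map⁻; ∈-++⁺ˡ; ∈-++⁺ʳ; ∈-filter⁺; ∈-filter⁻; foldr-selective)
open import Data.List.Properties using (foldr-forcesᵇ)
import Data.List.Relation.Unary.All as All
open import Data.List.Relation.Unary.Any using () renaming (here to hereᴸ)
open import Data.Product using (∃-syntax; _×_; _,_; proj₁)
open import Data.Sum using (_⊎_; inj₁; inj₂; [_,_]′)
import Data.Sum as Sum
open import Data.Empty using (⊥; ⊥-elim)
open import Function using (_∘_; const; case_of_)
open import Function.Bundles using (_↔_; _⇔_; Inverse; Injection; Equivalence; mk⇔; mk↔ₛ′)
open import Function.Properties.Inverse using (Inverse⇒Injection)
open import Function.Definitions using (Injective)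
open import Function.Construct.Symmetry using (↔-sym; ⇔-sym)
open import Function.Construct.Composition using (_↔-∘_; _⇔-∘_)
open import Function.Construct.Identity using (↔-id)
open import Relation.Nullary using (¬_; yes; no; contradiction)
open import Relation.Nullary.Negation using (¬¬-map)
open import Relation.Nullary.Decidable using (_×-dec_; decidable-stable)
open import Relation.Binary.PropositionalEquality
  using (_≡_; _≢_; refl; sym; trans; cong; subst; subst₂; module ≡-Reasoning)

open Equivalence using () renaming (to to ⇒; from to ⇐)

Maximal : ∀ {m} → (Subset m → Set) → Subset m → Set
Maximal {m} P B = P B × ((e : Fin m) → e ∉ B → ¬ P (⁅ e ⁆ ∪ B))

-- Every circuit inside C passes through both u and v, and C contains one.
OnCommonCircuit : ∀ {m} → (Subset m → Set) → Fin m → Fin m → Set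
OnCommonCircuit P u v = ∃[ C ] (¬ P C × P (C - u) × P (C - v))

onCommonCircuit-sym : ∀ {m} {P : Subset m → Set} {u v} → OnCommonCircuit P u v → OnCommonCircuit P v u
onCommonCircuit-sym (C , C-dependent , C-u-indep , C-v-indep) = C , C-dependent , C-v-indep , C-u-indep

⁅⁆⊆ : ∀ {n} {x : Fin n} {p : Subset n} → x ∈ p → ⁅ x ⁆ ⊆ p
⁅⁆⊆ {x = x} {p} x∈p y∈⁅x⁆ = subst (_∈ p) (sym (x∈⁅y⁆⇒x≡y x y∈⁅x⁆)) x∈p

∪-lub : ∀ {n} {p q r : Subset n} → p ⊆ r → q ⊆ r → p ∪ q ⊆ r
∪-lub {p = p} {q} p⊆r q⊆r x∈p∪q = [ p⊆r , q⊆r ]′ (x∈p∪q⁻ p q x∈p∪q)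

p⊆q∧∣q∣≤∣p∣⇒q⊆p : ∀ {n} {p q : Subset n} → p ⊆ q → ∣ q ∣ ≤ ∣ p ∣ → q ⊆ p
p⊆q∧∣q∣≤∣p∣⇒q⊆p {p = p} p⊆q ∣q∣≤∣p∣ {x} x∈q with x ∈? p
... | yes x∈p = x∈p
... | no  x∉p = contradiction ∣q∣≤∣p∣ (<⇒≱ (p⊂q⇒∣p∣<∣q∣ (p⊆q , x , x∈q , x∉p)))

∣⁅x⁆∪p∣≡1+∣p∣ : ∀ {n} (x : Fin n) (p : Subset n) → x ∉ p → ∣ ⁅ x ⁆ ∪ p ∣ ≡ suc ∣ p ∣
∣⁅x⁆∪p∣≡1+∣p∣ zero    (inside  ∷ p) x∉p = contradiction here x∉p
∣⁅x⁆∪p∣≡1+∣p∣ zero    (outside ∷ p) _   = cong (suc ∘ ∣_∣) (∪-identityˡ p)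
∣⁅x⁆∪p∣≡1+∣p∣ (suc x) (inside  ∷ p) x∉p = cong suc (∣⁅x⁆∪p∣≡1+∣p∣ x p (x∉p ∘ there))
∣⁅x⁆∪p∣≡1+∣p∣ (suc x) (outside ∷ p) x∉p = ∣⁅x⁆∪p∣≡1+∣p∣ x p (x∉p ∘ there)

x∈p─q⇒x∉q : ∀ {n} {x : Fin n} {p q : Subset n} → x ∈ p ─ q → x ∉ q
x∈p─q⇒x∉q {p = _ ∷ _} {q = inside ∷ _} () here
x∈p─q⇒x∉q {p = _ ∷ p} {q = _ ∷ q} (there x∈) (there x∈q) = x∈p─q⇒x∉q {p = p} {q} x∈ x∈q

⁅x⁆∪p-x≡p : ∀ {n} (x : Fin n) (p : Subset n) → x ∉ p → (⁅ x ⁆ ∪ p) - x ≡ p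
⁅x⁆∪p-x≡p zero    (inside  ∷ p) x∉p = contradiction here x∉p
⁅x⁆∪p-x≡p zero    (outside ∷ p) _   = cong (outside ∷_) (trans (p─⊥≡p (∅ ∪ p)) (∪-identityˡ p))
⁅x⁆∪p-x≡p (suc x) (s       ∷ p) x∉p = cong (s ∷_) (⁅x⁆∪p-x≡p x p (x∉p ∘ there))

module _ {m n : ℕ} (f : Fin m → Fin n) where

  lookup-pre : ∀ (Y : Subset n) i → lookup (pre f Y) i ≡ lookup Y (f i)
  lookup-pre Y = lookup∘tabulate (lookup Y ∘ f)

  ∈-pre⁻ : ∀ {Y x} → x ∈ pre f Y → f x ∈ Y
  ∈-pre⁻ {Y} {x} x∈ = lookup⇒[]= (f x) Y (trans (sym (lookup-pre Y x)) ([]=⇒lookup x∈))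

  ∈-pre⁺ : ∀ {Y x} → f x ∈ Y → x ∈ pre f Y
  ∈-pre⁺ {Y} {x} fx∈ = lookup⇒[]= x (pre f Y) (trans (lookup-pre Y x) ([]=⇒lookup fx∈))

  pre-∪ : ∀ (p q : Subset n) → pre f (p ∪ q) ≡ pre f p ∪ pre f q
  pre-∪ p q = ⊆-antisym
    (λ x∈ → x∈p∪q⁺ (Sum.map (∈-pre⁺ {p}) (∈-pre⁺ {q}) (x∈p∪q⁻ p q (∈-pre⁻ {p ∪ q} x∈))))
    (λ x∈ → ∈-pre⁺ {p ∪ q} (x∈p∪q⁺ (Sum.map (∈-pre⁻ {p}) (∈-pre⁻ {q}) (x∈p∪q⁻ (pre f p) (pre f q) x∈))))

  pre-─ : ∀ (p q : Subset n) → pre f (p ─ q) ≡ pre f p ─ pre f q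
  pre-─ p q = ⊆-antisym
    (λ x∈ → x∈p∧x∉q⇒x∈p─q (∈-pre⁺ {p} (p─q⊆p p q (∈-pre⁻ {p ─ q} x∈)))
                            (x∈p─q⇒x∉q {p = p} (∈-pre⁻ {p ─ q} x∈) ∘ ∈-pre⁻ {q}))
    (λ x∈ → ∈-pre⁺ {p ─ q} (x∈p∧x∉q⇒x∈p─q (∈-pre⁻ {p} (p─q⊆p (pre f p) (pre f q) x∈))
                                          (x∈p─q⇒x∉q {p = pre f p} x∈ ∘ ∈-pre⁺ {q})))

  pre-⁅⁆ : Injective _≡_ _≡_ f → ∀ x → pre f ⁅ f x ⁆ ≡ ⁅ x ⁆
  pre-⁅⁆ f-injective x = ⊆-antisym
    (λ y∈ → subst (_∈ ⁅ x ⁆) (sym (f-injective (x∈⁅y⁆⇒x≡y (f x) (∈-pre⁻ y∈)))) (x∈⁅x⁆ x))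
    (⁅⁆⊆ (∈-pre⁺ (x∈⁅x⁆ (f x))))

  pre-⁅⁆-∉image : ∀ {y} → (∀ x → f x ≢ y) → pre f ⁅ y ⁆ ≡ ∅
  pre-⁅⁆-∉image {y} y∉image = Empty-unique λ (x , x∈) → y∉image x (x∈⁅y⁆⇒x≡y y (∈-pre⁻ x∈))

pre-∘ : ∀ {k m n} (f : Fin k → Fin m) (g : Fin m → Fin n) (Y : Subset n) →
        pre f (pre g Y) ≡ pre (g ∘ f) Y
pre-∘ f g Y = tabulate-cong (lookup-pre g Y ∘ f)

module Bijection {m n : ℕ} (σ : Fin n ↔ Fin m) where
  open Inverse σ

  to-injective : Injective _≡_ _≡_ to
  to-injective = Injection.injective (Inverse⇒Injection σ)

  pre-to-⁅⁆ : ∀ y → pre to ⁅ y ⁆ ≡ ⁅ from y ⁆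
  pre-to-⁅⁆ y = subst (λ z → pre to ⁅ z ⁆ ≡ ⁅ from y ⁆) (strictlyInverseˡ y) (pre-⁅⁆ to to-injective (from y))

  pre-to-pre-from : ∀ (X : Subset n) → pre to (pre from X) ≡ X
  pre-to-pre-from X =
    trans (pre-∘ to from X) (trans (tabulate-cong (cong (lookup X) ∘ strictlyInverseʳ)) (tabulate∘lookup X))

  pre-to-insert : ∀ x (B : Subset m) → pre to (⁅ to x ⁆ ∪ B) ≡ ⁅ x ⁆ ∪ pre to B
  pre-to-insert x B = trans (pre-∪ to ⁅ to x ⁆ B) (cong (_∪ pre to B) (pre-⁅⁆ to to-injective x))

module Transport {m n : ℕ} {P : Subset m → Set} (Q : Subset n → Set)
                 (σ : Fin n ↔ Fin m) (hσ : ∀ Y → P Y ⇔ Q (pre (Inverse.to σ) Y)) where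
  open Inverse σ
  open Bijection σ

  reverse : ∀ X → Q X ⇔ P (pre from X)
  reverse X = subst (λ Z → Q Z ⇔ P (pre from X)) (pre-to-pre-from X) (⇔-sym (hσ (pre from X)))

  onCommonCircuit : ∀ {u v} → OnCommonCircuit P u v → OnCommonCircuit Q (from u) (from v)
  onCommonCircuit {u} {v} (C , C-dependent , C-u-indep , C-v-indep) =
    pre to C , C-dependent ∘ ⇐ (hσ C) , remove u C-u-indep , remove v C-v-indep
    where
    remove : ∀ w → P (C - w) → Q (pre to C - from w)
    remove w C-w-indep =
      subst Q (trans (pre-─ to C ⁅ w ⁆) (cong (pre to C ─_) (pre-to-⁅⁆ w))) (⇒ (hσ (C - w)) C-w-indep)

  maximal : ∀ {B} → Maximal P B → Maximal Q (pre to B)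
  maximal {B} (B-indep , B-maximal) = ⇒ (hσ B) B-indep , λ x x∉ x∪B-indep →
    B-maximal (to x) (x∉ ∘ ∈-pre⁺ to {B})
              (⇐ (hσ (⁅ to x ⁆ ∪ B)) (subst Q (sym (pre-to-insert x B)) x∪B-indep))

≅-via : ∀ {n m k} {M : Matroid n} {N : Matroid k} {P : Subset m → Set}
        (σ : Fin n ↔ Fin m) → (∀ Y → P Y ⇔ Indep M (pre (Inverse.to σ) Y)) →
        (ψ : Fin k ↔ Fin m) → (∀ Y → P Y ⇔ Indep N (pre (Inverse.to ψ) Y)) → N ≅ M
≅-via {M = M} {N} σ hσ ψ hψ = ↔-sym σ ↔-∘ ψ , λ X →
  subst (λ Z → Indep M X ⇔ Indep N Z) (pre-∘ (Inverse.to ψ) (Inverse.from σ) X)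
        (hψ (pre (Inverse.from σ) X) ⇔-∘ Transport.reverse (Indep M) σ hσ X)

inLeft : ∀ c {d} → Fin (c + d) → Bool
inLeft c k = [ const true , const false ]′ (splitAt c k)

module _ {c d : ℕ} where

  inLeft-↑ˡ : ∀ (i : Fin c) → inLeft c (i ↑ˡ d) ≡ true
  inLeft-↑ˡ i rewrite splitAt-↑ˡ c i d = refl

  inLeft-↑ʳ : ∀ (j : Fin d) → inLeft c (c ↑ʳ j) ≡ false
  inLeft-↑ʳ j rewrite splitAt-↑ʳ c d j = refl

  ↑ˡ≢↑ʳ : ∀ (i : Fin c) (j : Fin d) → i ↑ˡ d ≢ c ↑ʳ j
  ↑ˡ≢↑ʳ i j i≡j with trans (sym (inLeft-↑ˡ i)) (trans (cong (inLeft c) i≡j) (inLeft-↑ʳ j))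
  ... | ()

  data Summand : Fin (c + d) → Set where
    left  : ∀ i → Summand (i ↑ˡ d)
    right : ∀ j → Summand (c ↑ʳ j)

  summand : ∀ k → Summand k
  summand k with splitAt c k in eq
  ... | inj₁ i = subst Summand (splitAt⁻¹-↑ˡ eq) (left i)
  ... | inj₂ j = subst Summand (splitAt⁻¹-↑ʳ eq) (right j)

  constant-if-joined : ∀ {A : Set} (h : Fin (c + d) → A) → (∀ i j → h (i ↑ˡ d) ≡ h (c ↑ʳ j)) →
                       Fin c → Fin d → ∀ k l → h k ≡ h l
  constant-if-joined h joined i₀ j₀ k l = trans (toRight k) (sym (toRight l))
    where
    toRight : ∀ k → h k ≡ h (c ↑ʳ j₀)
    toRight k with summand k
    ... | left i  = joined i j₀
    ... | right j = trans (sym (joined i₀ j)) (joined i₀ j₀)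

module _ {a b : ℕ} where

  leftPart-++ : ∀ (L : Subset a) (R : Subset b) → leftPart {a} {b} (L ++ R) ≡ L
  leftPart-++ L R = trans (tabulate-cong (lookup-++ˡ L R)) (tabulate∘lookup L)

  rightPart-++ : ∀ (L : Subset a) (R : Subset b) → rightPart {a} {b} (L ++ R) ≡ R
  rightPart-++ L R = trans (tabulate-cong (lookup-++ʳ L R)) (tabulate∘lookup R)

  leftPart-⁅↑ˡ⁆ : ∀ i → leftPart {a} {b} ⁅ i ↑ˡ b ⁆ ≡ ⁅ i ⁆
  leftPart-⁅↑ˡ⁆ = pre-⁅⁆ (_↑ˡ b) (↑ˡ-injective b _ _)

  rightPart-⁅↑ʳ⁆ : ∀ j → rightPart {a} {b} ⁅ a ↑ʳ j ⁆ ≡ ⁅ j ⁆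
  rightPart-⁅↑ʳ⁆ = pre-⁅⁆ (a ↑ʳ_) (↑ʳ-injective a _ _)

  leftPart-⁅↑ʳ⁆ : ∀ j → leftPart {a} {b} ⁅ a ↑ʳ j ⁆ ≡ ∅
  leftPart-⁅↑ʳ⁆ j = pre-⁅⁆-∉image (_↑ˡ b) (λ i → ↑ˡ≢↑ʳ i j)

  rightPart-⁅↑ˡ⁆ : ∀ i → rightPart {a} {b} ⁅ i ↑ˡ b ⁆ ≡ ∅
  rightPart-⁅↑ˡ⁆ i = pre-⁅⁆-∉image (a ↑ʳ_) (λ j → ↑ˡ≢↑ʳ i j ∘ sym)

  leftPart-↑ˡ : ∀ Y i → leftPart {a} {b} (Y - (i ↑ˡ b)) ≡ leftPart {a} {b} Y - i
  leftPart-↑ˡ Y i = trans (pre-─ (_↑ˡ b) Y _) (cong (leftPart {a} {b} Y ─_) (leftPart-⁅↑ˡ⁆ i))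

  rightPart-↑ˡ : ∀ Y i → rightPart {a} {b} (Y - (i ↑ˡ b)) ≡ rightPart {a} {b} Y
  rightPart-↑ˡ Y i =
    trans (pre-─ (a ↑ʳ_) Y _) (trans (cong (rightPart {a} {b} Y ─_) (rightPart-⁅↑ˡ⁆ i)) (p─⊥≡p _))

  leftPart-↑ʳ : ∀ Y j → leftPart {a} {b} (Y - (a ↑ʳ j)) ≡ leftPart {a} {b} Y
  leftPart-↑ʳ Y j =
    trans (pre-─ (_↑ˡ b) Y _) (trans (cong (leftPart {a} {b} Y ─_) (leftPart-⁅↑ʳ⁆ j)) (p─⊥≡p _))

  rightPart-↑ʳ : ∀ Y j → rightPart {a} {b} (Y - (a ↑ʳ j)) ≡ rightPart {a} {b} Y - j
  rightPart-↑ʳ Y j = trans (pre-─ (a ↑ʳ_) Y _) (cong (rightPart {a} {b} Y ─_) (rightPart-⁅↑ʳ⁆ j))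

allSubsets-complete : ∀ {n} (p : Subset n) → p List.∈ allSubsets n
allSubsets-complete [] = hereᴸ refl
allSubsets-complete {suc n} (outside ∷ p) = ∈-++⁺ˡ (∈-map⁺ (outside ∷_) (allSubsets-complete p))
allSubsets-complete {suc n} (inside ∷ p) =
  ∈-++⁺ʳ (map (outside ∷_) (allSubsets n)) (∈-map⁺ (inside ∷_) (allSubsets-complete p))

maxList-upper : ∀ {x} xs → x List.∈ xs → x ≤ maxList xs
maxList-upper xs = All.lookup (foldr-forcesᵇ (λ x y ⊔≤ → m⊔n≤o⇒m≤o x y ⊔≤ , m⊔n≤o⇒n≤o x y ⊔≤) 0 xs ≤-refl)

maxList-sel : ∀ xs → maxList xs ≡ 0 ⊎ maxList xs List.∈ xs
maxList-sel = foldr-selective ⊔-sel 0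

module Rank {n : ℕ} (M : Matroid n) where

  private
    independentSubsetsOf : Subset n → List (Subset n)
    independentSubsetsOf A = filter (λ I → (I ⊆? A) ×-dec indep? M I) (allSubsets n)

  ∣I∣≤rk : ∀ {I A} → Indep M I → I ⊆ A → ∣ I ∣ ≤ rk M A
  ∣I∣≤rk {I} {A} I-indep I⊆A = maxList-upper _
    (∈-map⁺ ∣_∣ (∈-filter⁺ (λ J → (J ⊆? A) ×-dec indep? M J) (allSubsets-complete I) (I⊆A , I-indep)))

  rk-witness : ∀ A → ∃[ I ] (I ⊆ A × Indep M I × ∣ I ∣ ≡ rk M A)
  rk-witness A with maxList-sel (map ∣_∣ (independentSubsetsOf A))
  ... | inj₁ rk≡0 = ∅ , ⊆-min A , indep-⊥ M , trans (∣⊥∣≡0 n) (sym rk≡0)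
  ... | inj₂ rk∈ with ∈-map⁻ ∣_∣ rk∈
  ...   | I , I∈ , rk≡∣I∣ with ∈-filter⁻ (λ J → (J ⊆? A) ×-dec indep? M J) {xs = allSubsets n} I∈
  ...     | _ , I⊆A , I-indep = I , I⊆A , I-indep , sym rk≡∣I∣

  ∣I∣≤rank : ∀ {I} → Indep M I → ∣ I ∣ ≤ rank M
  ∣I∣≤rank I-indep = ∣I∣≤rk I-indep λ {x} _ → lookup⇒[]= x full (lookup∘tabulate (const inside) x)

  rk≤∣A∣ : ∀ A → rk M A ≤ ∣ A ∣
  rk≤∣A∣ A with rk-witness A
  ... | I , I⊆A , _ , ∣I∣≡rk = subst (_≤ ∣ A ∣) ∣I∣≡rk (p⊆q⇒∣p∣≤∣q∣ I⊆A)

  indep⇒rk≡∣A∣ : ∀ {A} → Indep M A → rk M A ≡ ∣ A ∣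
  indep⇒rk≡∣A∣ {A} A-indep = ≤-antisym (rk≤∣A∣ A) (∣I∣≤rk A-indep ⊆-refl)

  indep⇒nullity≡0 : ∀ {A} → Indep M A → nullity M A ≡ 0
  indep⇒nullity≡0 {A} A-indep = trans (cong (∣ A ∣ ∸_) (indep⇒rk≡∣A∣ A-indep)) (n∸n≡0 ∣ A ∣)

  nullity≡0⇒indep : ∀ {A} → nullity M A ≡ 0 → Indep M A
  nullity≡0⇒indep {A} ν≡0 with rk-witness A
  ... | I , I⊆A , I-indep , ∣I∣≡rk =
    indep-⊆ M (p⊆q∧∣q∣≤∣p∣⇒q⊆p I⊆A (subst (∣ A ∣ ≤_) (sym ∣I∣≡rk) (m∸n≡0⇒m≤n ν≡0))) I-indep

  nullity-insert : ∀ {y A k} → y ∉ A → k ≤ rk M (⁅ y ⁆ ∪ A) → nullity M (⁅ y ⁆ ∪ A) ≤ suc ∣ A ∣ ∸ k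
  nullity-insert {y} {A} {k} y∉A k≤rk =
    subst (λ s → s ∸ rk M (⁅ y ⁆ ∪ A) ≤ suc ∣ A ∣ ∸ k) (sym (∣⁅x⁆∪p∣≡1+∣p∣ y A y∉A))
          (∸-monoʳ-≤ (suc ∣ A ∣) k≤rk)

  augment-to : ∀ {I J} → Indep M I → Indep M J → ∣ J ∣ ≤ ∣ I ∣ →
               ∃[ J′ ] (J ⊆ J′ × Indep M J′ × ∣ J′ ∣ ≡ ∣ I ∣)
  augment-to {I} I-indep J-indep ∣J∣≤∣I∣ = go _ J-indep (m+[n∸m]≡n ∣J∣≤∣I∣)
    where
    go : ∀ k {J} → Indep M J → ∣ J ∣ + k ≡ ∣ I ∣ → ∃[ J′ ] (J ⊆ J′ × Indep M J′ × ∣ J′ ∣ ≡ ∣ I ∣)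
    go zero {J} J-indep ∣J∣+0≡ = J , ⊆-refl , J-indep , trans (sym (+-identityʳ ∣ J ∣)) ∣J∣+0≡
    go (suc k) {J} J-indep ∣J∣+k≡
      with indep-aug M J-indep I-indep (subst (∣ J ∣ <_) ∣J∣+k≡ (m<m+n ∣ J ∣ (s≤s z≤n)))
    ... | x , _ , x∉J , x∪J-indep
      with go k x∪J-indep (trans (cong (_+ k) (∣⁅x⁆∪p∣≡1+∣p∣ x J x∉J)) (trans (sym (+-suc ∣ J ∣ k)) ∣J∣+k≡))
    ...   | J′ , x∪J⊆J′ , J′-indep , ∣J′∣≡ = J′ , ⊆-trans (q⊆p∪q ⁅ x ⁆ J) x∪J⊆J′ , J′-indep , ∣J′∣≡

  basis-through : ∀ {x} → Indep M ⁅ x ⁆ → ∃[ B ] (x ∈ B × Indep M B × ∣ B ∣ ≡ rank M)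
  basis-through {x} x-indep with rk-witness full
  ... | B₀ , _ , B₀-indep , ∣B₀∣≡rank
    with augment-to B₀-indep x-indep (subst (∣ ⁅ x ⁆ ∣ ≤_) (sym ∣B₀∣≡rank) (∣I∣≤rank x-indep))
  ...   | B , ⁅x⁆⊆B , B-indep , ∣B∣≡ = B , ⁅x⁆⊆B (x∈⁅x⁆ x) , B-indep , trans ∣B∣≡ ∣B₀∣≡rank

  rk-augment : ∀ {A} → rk M A < rank M → ∃[ y ] (y ∉ A × rk M A < rk M (⁅ y ⁆ ∪ A))
  rk-augment {A} rk<rank with rk-witness A | rk-witness full
  ... | K , K⊆A , K-indep , ∣K∣≡rk | B , _ , B-indep , ∣B∣≡rank
    with indep-aug M K-indep B-indep (subst₂ _<_ (sym ∣K∣≡rk) (sym ∣B∣≡rank) rk<rank)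
  ... | y , _ , y∉K , y∪K-indep = y , y∉A , rk-grows (∪-lub (p⊆p∪q A) (⊆-trans K⊆A (q⊆p∪q ⁅ y ⁆ A)))
    where
    rk-grows : ∀ {A′} → ⁅ y ⁆ ∪ K ⊆ A′ → rk M A < rk M A′
    rk-grows y∪K⊆A′ = subst (_≤ _) (trans (∣⁅x⁆∪p∣≡1+∣p∣ y K y∉K) (cong suc ∣K∣≡rk)) (∣I∣≤rk y∪K-indep y∪K⊆A′)
    y∉A : y ∉ A
    y∉A y∈A = <-irrefl refl (rk-grows (∪-lub (⁅⁆⊆ y∈A) K⊆A))

module FreeProduct {a b : ℕ} (N₁ : Matroid a) (N₂ : Matroid b) where
  open Rank

  private
    Indep□ : Subset a → Subset b → Set
    Indep□ L R = Indep N₁ L × nullity N₂ R ≤ corank N₁ L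

  rank≤rk-rightPart : ∀ {B} → Maximal (FreeProdIndep N₁ N₂) B → rank N₂ ≤ rk N₂ (rightPart {a} {b} B)
  rank≤rk-rightPart {B} ((L-indep , ν≤λ) , B-maximal) = ≮⇒≥ λ rk<rank → extend (rk-augment N₂ rk<rank)
    where
    L = leftPart {a} {b} B
    R = rightPart {a} {b} B
    extend : ∃[ y ] (y ∉ R × rk N₂ R < rk N₂ (⁅ y ⁆ ∪ R)) → ⊥
    extend (y , y∉R , rk<) = B-maximal (a ↑ʳ y) (y∉R ∘ ∈-pre⁺ (a ↑ʳ_) {B})
      (subst₂ Indep□ (sym left≡) (sym right≡) (L-indep , ≤-trans (nullity-insert N₂ y∉R rk<) ν≤λ))
      where
      left≡ : leftPart {a} {b} (⁅ a ↑ʳ y ⁆ ∪ B) ≡ L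
      left≡ = trans (pre-∪ (_↑ˡ b) ⁅ a ↑ʳ y ⁆ B) (trans (cong (_∪ L) (leftPart-⁅↑ʳ⁆ y)) (∪-identityˡ L))
      right≡ : rightPart {a} {b} (⁅ a ↑ʳ y ⁆ ∪ B) ≡ ⁅ y ⁆ ∪ R
      right≡ = trans (pre-∪ (a ↑ʳ_) ⁅ a ↑ʳ y ⁆ B) (cong (_∪ R) (rightPart-⁅↑ʳ⁆ {a} y))

  onCommonCircuit-↑ˡ-↑ʳ : ∀ {i j K} → Indep N₁ ⁅ i ⁆ → Indep N₂ K → j ∉ K → rank N₂ ≤ ∣ K ∣ →
                          OnCommonCircuit (FreeProdIndep N₁ N₂) (i ↑ˡ b) (a ↑ʳ j)
  onCommonCircuit-↑ˡ-↑ʳ {i} {j} {K} i-indep K-indep j∉K rank≤∣K∣ with basis-through N₁ i-indep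
  ... | B , i∈B , B-indep , ∣B∣≡rank = B ++ J , dependent , without-i , without-j
    where
    J = ⁅ j ⁆ ∪ K

    dependent : ¬ FreeProdIndep N₁ N₂ (B ++ J)
    dependent C-indep with subst₂ Indep□ (leftPart-++ B J) (rightPart-++ B J) C-indep
    ... | _ , ν≤λ = <-irrefl refl (≤-trans ∣J∣≤rank rank≤∣K∣)
      where
      corank≡0 : corank N₁ B ≡ 0
      corank≡0 = trans (cong (rank N₁ ∸_) (trans (indep⇒rk≡∣A∣ N₁ B-indep) ∣B∣≡rank)) (n∸n≡0 (rank N₁))
      ∣J∣≤rank : suc ∣ K ∣ ≤ rank N₂
      ∣J∣≤rank = subst (_≤ rank N₂) (∣⁅x⁆∪p∣≡1+∣p∣ j K j∉K)
        (∣I∣≤rank N₂ (nullity≡0⇒indep N₂ (n≤0⇒n≡0 (subst (nullity N₂ J ≤_) corank≡0 ν≤λ))))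

    without-i : FreeProdIndep N₁ N₂ ((B ++ J) - (i ↑ˡ b))
    without-i = subst₂ Indep□ (sym left≡) (sym right≡) (B-i-indep , ≤-trans ν≤1 1≤λ)
      where
      left≡ : leftPart {a} {b} ((B ++ J) - (i ↑ˡ b)) ≡ B - i
      left≡ = trans (leftPart-↑ˡ (B ++ J) i) (cong (_- i) (leftPart-++ B J))
      right≡ : rightPart {a} {b} ((B ++ J) - (i ↑ˡ b)) ≡ J
      right≡ = trans (rightPart-↑ˡ (B ++ J) i) (rightPart-++ B J)
      B-i-indep : Indep N₁ (B - i)
      B-i-indep = indep-⊆ N₁ (p─q⊆p B ⁅ i ⁆) B-indep
      ν≤1 : nullity N₂ J ≤ 1
      ν≤1 = subst (nullity N₂ J ≤_) (m+n∸n≡m 1 ∣ K ∣) (nullity-insert N₂ j∉K (∣I∣≤rk N₂ K-indep (q⊆p∪q ⁅ j ⁆ K)))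
      1≤λ : 1 ≤ corank N₁ (B - i)
      1≤λ = m<n⇒0<n∸m (subst₂ _<_ (sym (indep⇒rk≡∣A∣ N₁ B-i-indep)) ∣B∣≡rank (x∈p⇒∣p-x∣<∣p∣ i∈B))

    without-j : FreeProdIndep N₁ N₂ ((B ++ J) - (a ↑ʳ j))
    without-j = subst₂ Indep□ (sym left≡) (sym right≡)
      (B-indep , subst (_≤ corank N₁ B) (sym (indep⇒nullity≡0 N₂ K-indep)) z≤n)
      where
      left≡ : leftPart {a} {b} ((B ++ J) - (a ↑ʳ j)) ≡ B
      left≡ = trans (leftPart-↑ʳ (B ++ J) j) (leftPart-++ B J)
      right≡ : rightPart {a} {b} ((B ++ J) - (a ↑ʳ j)) ≡ K
      right≡ = trans (rightPart-↑ʳ (B ++ J) j) (trans (cong (_- j) (rightPart-++ B J)) (⁅x⁆∪p-x≡p j K j∉K))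

  onCommonCircuit-outside-basis : ∀ {i j B} → Indep N₁ ⁅ i ⁆ → Maximal (FreeProdIndep N₁ N₂) B → a ↑ʳ j ∉ B →
                                  OnCommonCircuit (FreeProdIndep N₁ N₂) (i ↑ˡ b) (a ↑ʳ j)
  onCommonCircuit-outside-basis {B = B} i-indep B-maximal t∉B with rk-witness N₂ (rightPart {a} {b} B)
  ... | K , K⊆R , K-indep , ∣K∣≡rk = onCommonCircuit-↑ˡ-↑ʳ i-indep K-indep (t∉B ∘ ∈-pre⁻ (a ↑ʳ_) {B} ∘ K⊆R)
    (subst (rank N₂ ≤_) (sym ∣K∣≡rk) (rank≤rk-rightPart B-maximal))

module DirectSum {c d : ℕ} (D₁ : Matroid c) (D₂ : Matroid d) where

  ¬onCommonCircuit-↑ˡ-↑ʳ : ∀ i j → ¬ OnCommonCircuit (DirectSumIndep D₁ D₂) (i ↑ˡ d) (c ↑ʳ j)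
  ¬onCommonCircuit-↑ˡ-↑ʳ i j (C , C-dependent , (_ , R-indep) , (L-indep , _)) =
    C-dependent (subst (Indep D₁) (leftPart-↑ʳ C j) L-indep , subst (Indep D₂) (rightPart-↑ˡ C i) R-indep)

  onCommonCircuit⇒sameSummand : ∀ {u v} → OnCommonCircuit (DirectSumIndep D₁ D₂) u v → inLeft c u ≡ inLeft c v
  onCommonCircuit⇒sameSummand {u} {v} linked with summand {c} {d} u | summand {c} {d} v
  ... | left i  | left i′  = trans (inLeft-↑ˡ {d = d} i) (sym (inLeft-↑ˡ i′))
  ... | right j | right j′ = trans (inLeft-↑ʳ {c} j) (sym (inLeft-↑ʳ {c} j′))
  ... | left i  | right j  = ⊥-elim (¬onCommonCircuit-↑ˡ-↑ʳ i j linked)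
  ... | right j | left i   = ⊥-elim (¬onCommonCircuit-↑ˡ-↑ʳ i j (onCommonCircuit-sym linked))

module _ {n a b : ℕ} {M : Matroid n} {N₁ : Matroid a} {N₂ : Matroid b}
         (loopless : Loopless M) (isthmusless : Isthmusless M) (σ : Fin n ↔ Fin (a + b))
         (hσ : ∀ Y → FreeProdIndep N₁ N₂ Y ⇔ Indep M (pre (Inverse.to σ) Y)) where
  open Inverse σ

  factors-onCommonCircuit : ∀ i j → ¬ ¬ OnCommonCircuit (Indep M) (from (i ↑ˡ b)) (from (a ↑ʳ j))
  factors-onCommonCircuit i j ¬linked =
    isthmusless t λ B B-basis → decidable-stable (t ∈? B) (¬linked ∘ linked B-basis)
    where
    t = from (a ↑ʳ j)

    i-indep : Indep N₁ ⁅ i ⁆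
    i-indep = subst (Indep N₁) (leftPart-⁅↑ˡ⁆ i) (proj₁ (⇐ (hσ ⁅ i ↑ˡ b ⁆) s-indep))
      where
      s-indep : Indep M (pre to ⁅ i ↑ˡ b ⁆)
      s-indep = subst (Indep M) (sym (Bijection.pre-to-⁅⁆ σ (i ↑ˡ b)))
                      (decidable-stable (indep? M _) (loopless (from (i ↑ˡ b))))

    linked : ∀ {B} → IsBasis M B → t ∉ B → OnCommonCircuit (Indep M) (from (i ↑ˡ b)) t
    linked {B} B-basis t∉B = Transport.onCommonCircuit (Indep M) σ hσ
      (FreeProduct.onCommonCircuit-outside-basis N₁ N₂ i-indep B′-maximal (t∉B ∘ ∈-pre⁻ from {B}))
      where
      B′-maximal : Maximal (FreeProdIndep N₁ N₂) (pre from B)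
      B′-maximal = Transport.maximal (FreeProdIndep N₁ N₂) (↔-sym σ) (Transport.reverse (Indep M) σ hσ) B-basis

no-free-factorization : ∀ {n a b c d} {M : Matroid n} {N₁ : Matroid a} {N₂ : Matroid b}
                          {D₁ : Matroid c} {D₂ : Matroid d} →
                        Loopless M → Isthmusless M →
                        IsoTo M (DirectSumIndep D₁ D₂) → IsoTo M (FreeProdIndep N₁ N₂) →
                        Fin a → Fin b → Fin c → Fin d → ⊥
no-free-factorization {n} {c = c} {d} {M = M} {N₁} {N₂} {D₁} {D₂}
                      loopless isthmusless (τ , hτ) (σ , hσ) i₀ j₀ k₀ l₀ =
  case true≡false of λ ()
  where
  open ≡-Reasoning

  side : Fin n → Bool
  side = inLeft c ∘ Inverse.to τ

  sameSide : ∀ {x y} → OnCommonCircuit (Indep M) x y → side x ≡ side y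
  sameSide = DirectSum.onCommonCircuit⇒sameSummand D₁ D₂
           ∘ Transport.onCommonCircuit (DirectSumIndep D₁ D₂) (↔-sym τ) (Transport.reverse (Indep M) τ hτ)

  joined : ∀ i j → side (Inverse.from σ (i ↑ˡ _)) ≡ side (Inverse.from σ (_ ↑ʳ j))
  joined i j = decidable-stable (side _ Bool.≟ side _)
    (¬¬-map sameSide (factors-onCommonCircuit {M = M} {N₁} {N₂} loopless isthmusless σ hσ i j))

  side-constant : ∀ x y → side x ≡ side y
  side-constant x y = begin
    side x                                  ≡⟨ cong side (Inverse.strictlyInverseʳ σ x) ⟨
    side (Inverse.from σ (Inverse.to σ x))  ≡⟨ constant-if-joined (side ∘ Inverse.from σ) joined i₀ j₀ _ _ ⟩
    side (Inverse.from σ (Inverse.to σ y))  ≡⟨ cong side (Inverse.strictlyInverseʳ σ y) ⟩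
    side y                                  ∎

  side-from : ∀ k → side (Inverse.from τ k) ≡ inLeft c k
  side-from k = cong (inLeft c) (Inverse.strictlyInverseˡ τ k)

  true≡false : true ≡ false
  true≡false = begin
    true                             ≡⟨ inLeft-↑ˡ {d = d} k₀ ⟨
    inLeft c (k₀ ↑ˡ d)               ≡⟨ side-from (k₀ ↑ˡ d) ⟨
    side (Inverse.from τ (k₀ ↑ˡ d))  ≡⟨ side-constant _ _ ⟩
    side (Inverse.from τ (c ↑ʳ l₀))  ≡⟨ side-from (c ↑ʳ l₀) ⟩
    inLeft c (c ↑ʳ l₀)               ≡⟨ inLeft-↑ʳ {c} l₀ ⟩
    false                            ∎

↔-↑ˡ0 : ∀ {a} → Fin a ↔ Fin (a + 0)
↔-↑ˡ0 {a} = mk↔ₛ′ (_↑ˡ 0) (cast (+-identityʳ a))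
  (λ k → toℕ-injective (trans (toℕ-↑ˡ (cast _ k) 0) (toℕ-cast _ k)))
  (λ i → toℕ-injective (trans (toℕ-cast _ (i ↑ˡ 0)) (toℕ-↑ˡ i 0)))

freeProduct-emptyʳ : ∀ {a} (N₁ : Matroid a) (N₂ : Matroid 0) Y →
                     FreeProdIndep N₁ N₂ Y ⇔ Indep N₁ (leftPart {a} {0} Y)
freeProduct-emptyʳ {a} N₁ N₂ Y = mk⇔ proj₁ (λ L-indep → L-indep , nullity≤ (rightPart {a} {0} Y))
  where
  nullity≤ : ∀ (R : Subset 0) → nullity N₂ R ≤ corank N₁ (leftPart {a} {0} Y)
  nullity≤ [] = subst (_≤ corank N₁ (leftPart {a} {0} Y)) (sym (0∸n≡0 (rk N₂ []))) z≤n

freeProduct-emptyˡ : ∀ {b} (N₁ : Matroid 0) (N₂ : Matroid b) Y →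
                     FreeProdIndep N₁ N₂ Y ⇔ Indep N₂ (rightPart {0} {b} Y)
freeProduct-emptyˡ {b} N₁ N₂ Y = byLeftPart (leftPart {0} {b} Y)
  where
  R = rightPart {0} {b} Y
  byLeftPart : ∀ L → (Indep N₁ L × nullity N₂ R ≤ corank N₁ L) ⇔ Indep N₂ R
  byLeftPart [] = mk⇔
    (λ (_ , ν≤λ) → Rank.nullity≡0⇒indep N₂ (n≤0⇒n≡0 (subst (nullity N₂ R ≤_) (n∸n≡0 (rk N₁ [])) ν≤λ)))
    (λ R-indep → indep-⊥ N₁ , subst (_≤ corank N₁ []) (sym (Rank.indep⇒nullity≡0 N₂ R-indep)) z≤n)

corollary6p5 : {n : ℕ} (M : Matroid n) → Loopless M → Isthmusless M → Disconnected M → Irreducible M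
corollary6p5 M loopless isthmusless (suc _ , suc _ , s≤s _ , s≤s _ , D₁ , D₂ , τ , hτ) =
  ≤-trans (s≤s z≤n) (toℕ<n (Inverse.from τ zero)) , factorization
  where
  factorization : (F : FreeFactorization M) → FreeFactorization.N₁ F ≅ M ⊎ FreeFactorization.N₂ F ≅ M
  factorization record { b = zero ; N₁ = N₁ ; N₂ = N₂ ; iso = σ , hσ } =
    inj₁ (≅-via {M = M} {N₁} σ hσ ↔-↑ˡ0 (freeProduct-emptyʳ N₁ N₂))
  -- 0 ↑ʳ j reduces to j, so rightPart {0} is the preimage under the identity.
  factorization record { a = zero ; b = suc _ ; N₁ = N₁ ; N₂ = N₂ ; iso = σ , hσ } =
    inj₂ (≅-via {M = M} {N₂} σ hσ (↔-id _) (freeProduct-emptyˡ N₁ N₂))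
  factorization record { a = suc _ ; b = suc _ ; N₁ = N₁ ; N₂ = N₂ ; iso = iso } =
    ⊥-elim (no-free-factorization {M = M} {N₁} {N₂} {D₁} {D₂}
                                  loopless isthmusless (τ , hτ) iso zero zero zero zero)
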